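{- Independent sets can be taught in $O(n^2)$ rounds: for every graph $G$ with vertex set $V=\{1,\dots,n\}$ there exist a set $P_G$ of positive examples and a set $N_G$ of negative examples for the independent set concept with $|P_G|+|N_G|=O(n^2)$, such that every graph $H$ on $V$ consistent with these examples has exactly the same independent sets as $G$.
   Context: An independent set of $G$ is a set of vertices no two of which are adjacent. Teaching model: for a vertex set concept $\Phi$ and a graph $G$ on $V$, a positive example is a set $V'\subseteq V$ with $\Phi(G,V')$ true, and a negative example is a set $V'\subseteq V$ with $\Phi(G,V')$ false. A graph $H$ on $V$ is consistent with example sets $P,N$ if $\Phi(H,V')$ holds for every $V'\in P$ and fails for every $V'\in N$. The concept can be taught in $g(n)$ rounds if, for every graph $G$ of order $n$, there exist $P_G,N_G$ with $|P_G|+|N_G|\le g(n)$ such that every graph $H$ on $V$ consistent with $P_G,N_G$ is $\Phi$-equivalent to $G$, i.e. $\{V':\Phi(H,V')\}=\{V':\Phi(G,V')\}$. -}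

module Defs where

open import Data.Nat using (ℕ)
open import Data.Bool using (Bool; true; false)
open import Data.Fin using (Fin)
open import Data.Fin.Subset using (Subset; _∈_)
open import Data.List using (List)
open import Data.List.Relation.Unary.All using (All)
open import Relation.Binary.PropositionalEquality using (_≡_)
open import Relation.Nullary using (¬_)
open import Data.Product using (_×_)

-- A finite simple (undirected, loopless) graph on vertex set Fin n
-- (standing for V = {1,…,n}), given by its adjacency relation.
record Graph (n : ℕ) : Set where
  field
    adj   : Fin n → Fin n → Bool
    sym   : ∀ i j → adj i j ≡ adj j i
    irref : ∀ i → adj i i ≡ false
open Graph public

Independent : ∀ {n} → Graph n → Subset n → Set
Independent G S = ∀ i j → i ∈ S → j ∈ S → adj G i j ≡ false

Consistent : ∀ {n} → Graph n → List (Subset n) → List (Subset n) → Set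
Consistent H P N = All (Independent H) P × All (λ S → ¬ Independent H S) N

IndEquivalent : ∀ {n} → Graph n → Graph n → Set
IndEquivalent H G = ∀ S → (Independent H S → Independent G S) × (Independent G S → Independent H S)

{-# OPTIONS --safe #-}
-- A pair set {a, b} is independent exactly when ab is not an edge. Labelling each of the n²
-- pair sets (a = b allowed) as a positive or a negative example therefore forces every
-- consistent graph to have the adjacency relation of G, and independence depends on nothing else.
module Submission where

open import Defs
open import Data.Nat using (ℕ; suc; _+_; _*_; _≤_)
open import Data.Nat.Properties using (+-suc; *-identityˡ; ≤-reflexive)
open import Data.Bool using (true; false)
open import Data.Bool.Properties using (¬-not) renaming (_≟_ to _≟ᵇ_)
open import Data.Fin using (Fin)
open import Data.Fin.Subset using (Subset; ⁅_⁆; _∪_) renaming (_∈_ to _∈ₛ_)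
open import Data.Fin.Subset.Properties using (x∈⁅x⁆; x∈⁅y⁆⇒x≡y; x∈p∪q⁻; x∈p∪q⁺)
open import Data.List using (List; []; _∷_; length; map; filter; cartesianProduct; allFin)
open import Data.List.Properties using (length-map; length-++; length-tabulate)
open import Data.List.Membership.Propositional using (_∈_)
open import Data.List.Membership.Propositional.Properties
  using (∈-map⁺; ∈-filter⁺; ∈-cartesianProduct⁺; ∈-allFin)
open import Data.List.Relation.Unary.All using (lookup) renaming (map to All-map)
open import Data.List.Relation.Unary.All.Properties using (all-filter; map⁺)
open import Data.Product using (Σ; _×_; _,_; ∃-syntax; uncurry)
open import Data.Sum using (_⊎_; inj₁; inj₂)
open import Function using (_∘_)
open import Relation.Binary.PropositionalEquality
  using (_≡_; refl; trans; cong; cong₂; module ≡-Reasoning) renaming (sym to ≡-sym)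
open import Relation.Nullary using (does; yes; no)
open import Relation.Unary using (Pred; Decidable)
open import Relation.Unary.Properties using (∁?)

module _ {a p} {A : Set a} {P : Pred A p} (P? : Decidable P) where

  length-filter+length-filter-∁ : ∀ xs →
    length (filter P? xs) + length (filter (∁? P?) xs) ≡ length xs
  length-filter+length-filter-∁ []       = refl
  length-filter+length-filter-∁ (x ∷ xs) with ih ← length-filter+length-filter-∁ xs | does (P? x)
  ... | true  = cong suc ih
  ... | false = trans (+-suc _ _) (cong suc ih)

length-cartesianProduct : ∀ {a b} {A : Set a} {B : Set b} (xs : List A) (ys : List B) →
  length (cartesianProduct xs ys) ≡ length xs * length ys
length-cartesianProduct []       ys = refl
length-cartesianProduct (x ∷ xs) ys =
  trans (length-++ (map (x ,_) ys))
        (cong₂ _+_ (length-map (x ,_) ys) (length-cartesianProduct xs ys))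

module _ {n : ℕ} where

  pairSet : Fin n → Fin n → Subset n
  pairSet a b = ⁅ a ⁆ ∪ ⁅ b ⁆

  ∈-pairSetˡ : ∀ a b → a ∈ₛ pairSet a b
  ∈-pairSetˡ a b = x∈p∪q⁺ (inj₁ (x∈⁅x⁆ a))

  ∈-pairSetʳ : ∀ a b → b ∈ₛ pairSet a b
  ∈-pairSetʳ a b = x∈p∪q⁺ (inj₂ (x∈⁅x⁆ b))

  ∈-pairSet⁻ : ∀ {a b x} → x ∈ₛ pairSet a b → x ≡ a ⊎ x ≡ b
  ∈-pairSet⁻ {a} {b} x∈ with x∈p∪q⁻ ⁅ a ⁆ ⁅ b ⁆ x∈
  ... | inj₁ x∈⁅a⁆ = inj₁ (x∈⁅y⁆⇒x≡y a x∈⁅a⁆)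
  ... | inj₂ x∈⁅b⁆ = inj₂ (x∈⁅y⁆⇒x≡y b x∈⁅b⁆)

  independent-pairSet : ∀ (K : Graph n) {a b} → adj K a b ≡ false → Independent K (pairSet a b)
  independent-pairSet K ab∉K x y x∈ y∈ with ∈-pairSet⁻ x∈ | ∈-pairSet⁻ y∈
  ... | inj₁ refl | inj₁ refl = irref K x
  ... | inj₁ refl | inj₂ refl = ab∉K
  ... | inj₂ refl | inj₁ refl = trans (sym K x y) ab∉K
  ... | inj₂ refl | inj₂ refl = irref K x

  independent-pairSet⁻ : ∀ (K : Graph n) {a b} → Independent K (pairSet a b) → adj K a b ≡ false
  independent-pairSet⁻ K {a} {b} ind = ind a b (∈-pairSetˡ a b) (∈-pairSetʳ a b)

  same-adj⇒IndEquivalent : ∀ (H G : Graph n) → (∀ a b → adj H a b ≡ adj G a b) → IndEquivalent H G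
  same-adj⇒IndEquivalent H G H≗G S =
    (λ indH a b a∈ b∈ → trans (≡-sym (H≗G a b)) (indH a b a∈ b∈)) ,
    (λ indG a b a∈ b∈ → trans (H≗G a b) (indG a b a∈ b∈))

vertexPairs : ∀ n → List (Fin n × Fin n)
vertexPairs n = cartesianProduct (allFin n) (allFin n)

∈-vertexPairs : ∀ {n} (a b : Fin n) → (a , b) ∈ vertexPairs n
∈-vertexPairs a b = ∈-cartesianProduct⁺ (∈-allFin a) (∈-allFin b)

length-vertexPairs : ∀ n → length (vertexPairs n) ≡ n * n
length-vertexPairs n =
  trans (length-cartesianProduct (allFin n) (allFin n))
        (cong₂ _*_ (length-tabulate {n = n} _) (length-tabulate {n = n} _))

module _ {n : ℕ} (G : Graph n) where

  NonEdge : Pred (Fin n × Fin n) _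
  NonEdge (a , b) = adj G a b ≡ false

  nonEdge? : Decidable NonEdge
  nonEdge? (a , b) = adj G a b ≟ᵇ false

  positiveExamples : List (Subset n)
  positiveExamples = map (uncurry pairSet) (filter nonEdge? (vertexPairs n))

  negativeExamples : List (Subset n)
  negativeExamples = map (uncurry pairSet) (filter (∁? nonEdge?) (vertexPairs n))

  consistent-examples : Consistent G positiveExamples negativeExamples
  consistent-examples =
    map⁺ (All-map (independent-pairSet G) (all-filter nonEdge? (vertexPairs n))) ,
    map⁺ (All-map (λ ab∈G → ab∈G ∘ independent-pairSet⁻ G)
                  (all-filter (∁? nonEdge?) (vertexPairs n)))

  length-examples : length positiveExamples + length negativeExamples ≡ n * n
  length-examples = begin
    length positiveExamples + length negativeExamples
      ≡⟨ cong₂ _+_ (length-map (uncurry pairSet) (filter nonEdge? (vertexPairs n)))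
                   (length-map (uncurry pairSet) (filter (∁? nonEdge?) (vertexPairs n))) ⟩
    length (filter nonEdge? (vertexPairs n)) + length (filter (∁? nonEdge?) (vertexPairs n))
      ≡⟨ length-filter+length-filter-∁ nonEdge? (vertexPairs n) ⟩
    length (vertexPairs n)
      ≡⟨ length-vertexPairs n ⟩
    n * n ∎
    where open ≡-Reasoning

  consistent⇒same-adj : ∀ (H : Graph n) → Consistent H positiveExamples negativeExamples →
                        ∀ a b → adj H a b ≡ adj G a b
  consistent⇒same-adj H (indP , ¬indN) a b with adj G a b ≟ᵇ false
  ... | yes ab∉G = trans (independent-pairSet⁻ H (lookup indP pos∈)) (≡-sym ab∉G)
    where pos∈ = ∈-map⁺ (uncurry pairSet) (∈-filter⁺ nonEdge? (∈-vertexPairs a b) ab∉G)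
  ... | no ab∈G = trans (¬-not (lookup ¬indN neg∈ ∘ independent-pairSet H)) (≡-sym (¬-not ab∈G))
    where neg∈ = ∈-map⁺ (uncurry pairSet) (∈-filter⁺ (∁? nonEdge?) (∈-vertexPairs a b) ab∈G)

theorem3p2 : ∃[ c ] ∃[ n₀ ] (∀ (n : ℕ) → n₀ ≤ n → (G : Graph n) →
                 Σ (List (Subset n)) λ P → Σ (List (Subset n)) λ N →
                   Consistent G P N ×
                   (length P + length N ≤ c * (n * n)) ×
                   (∀ (H : Graph n) → Consistent H P N → IndEquivalent H G))
theorem3p2 = 1 , 0 , λ n _ G →
  positiveExamples G , negativeExamples G ,
  consistent-examples G ,
  ≤-reflexive (trans (length-examples G) (≡-sym (*-identityˡ (n * n)))) ,
  λ H consistent → same-adj⇒IndEquivalent H G (consistent⇒same-adj G H consistent)
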